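{- Let $x$ be an element of a c-quantale. The following are equivalent: (1) $x$ is wellfounded, i.e. for all $y$, $d(y)\le d(x\cdot y)$ implies $d(y)=0$; (2) $x$ is deflationary, i.e. for all $y$, $y\le x\cdot y$ implies $y=0$; (3) $x$ is $\omega$-trivial, i.e. $x^\omega=0$.
   Context: A proto-quantale is $(Q,\le,\cdot)$ with $(Q,\le)$ a complete lattice, $x\le y\Rightarrow z\cdot x\le z\cdot y$, and $(\sum_{i\in I}x_i)\cdot y=\sum_{i\in I}(x_i\cdot y)$; it is unital with unit $1$ if $1\cdot x=x=x\cdot 1$. A (commutative) quantale additionally has associative (commutative) multiplication and $x\cdot\sum_i y_i=\sum_i x\cdot y_i$. A proto-bi-quantale is $(Q,\le,\cdot,\|,1_\sigma,1_\pi)$ with $(Q,\le,\cdot,1_\sigma)$ a unital proto-quantale and $(Q,\le,\|,1_\pi)$ a unital commutative quantale. A c-quantale is a proto-bi-quantale which, with $+$ the binary supremum, $\sqcap$ the binary infimum, $0$ the least and $U$ the greatest element and a distinguished element $\overline{1}_\pi$, is a c-lattice: $(Q,+,\sqcap,0,U)$ is distributive and for all $x,y,z$: (cl1) $x\cdot 1_\pi+x\cdot\overline{1}_\pi=x\cdot U$; (cl2) $1_\pi\sqcap(x+\overline{1}_\pi)=x\cdot 0$; (cl3) $x\cdot(y\|z)\le(x\cdot y)\|(x\cdot z)$; (cl4) $z\|z\le z\Rightarrow (x\|y)\cdot z=(x\cdot z)\|(y\cdot z)$; (cl5) $x\cdot(y\cdot(z\cdot 0))=(x\cdot y)\cdot(z\cdot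 0)$; (cl6) $(x\cdot 0)\cdot y=x\cdot(0\cdot y)$; (cl7) $1_\sigma\|1_\sigma=1_\sigma$; (cl8) $((x\cdot 1_\pi)\|1_\sigma)\cdot y=(x\cdot 1_\pi)\|y$; (cl9) $((x\sqcap 1_\sigma)\cdot 1_\pi)\|1_\sigma=x\sqcap 1_\sigma$; (cl10) $((x\sqcap\overline{1}_\pi)\cdot 1_\pi)\|1_\sigma=1_\sigma\sqcap((x\sqcap\overline{1}_\pi)\cdot\overline{1}_\pi)$; (cl11) $((x\sqcap\overline{1}_\pi)\cdot 1_\pi)\|\overline{1}_\pi=(x\sqcap\overline{1}_\pi)\cdot\overline{1}_\pi$. Domain: $d(x)=(x\cdot 1_\pi)\|1_\sigma$. For an element $x$, $x^\omega$ is the greatest fixpoint of the isotone map $y\mapsto x\cdot y$. -}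

module Defs where

open import Level using (Level; Lift; lift; _⊔_) renaming (suc to lsuc)
open import Data.Bool using (Bool; true; false)
open import Data.Empty using (⊥)
open import Data.Product using (Σ; _×_; proj₁)
open import Relation.Binary.PropositionalEquality using (_≡_)

record CQuantale (c : Level) : Set (lsuc c) where
  infix  4 _≤_
  infixl 7 _·_
  infixl 6 _‖_
  field
    Carrier : Set c
    _≤_     : Carrier → Carrier → Set c
    ≤-refl    : ∀ {x} → x ≤ x
    ≤-trans   : ∀ {x y z} → x ≤ y → y ≤ z → x ≤ z
    ≤-antisym : ∀ {x y} → x ≤ y → y ≤ x → x ≡ y
    -- completeness: every family (indexed by a set of the carrier's level,
    -- hence in particular every subset of the carrier) has a supremum
    ⋁       : {I : Set c} → (I → Carrier) → Carrier
    ⋁-upper : {I : Set c} (f : I → Carrier) (i : I) → f i ≤ ⋁ f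
    ⋁-least : {I : Set c} (f : I → Carrier) (z : Carrier) →
              (∀ i → f i ≤ z) → ⋁ f ≤ z

  _+_ : Carrier → Carrier → Carrier
  x + y = ⋁ {I = Lift c Bool} (λ { (lift true) → x ; (lift false) → y })

  _⊓_ : Carrier → Carrier → Carrier
  x ⊓ y = ⋁ {I = Σ Carrier (λ z → (z ≤ x) × (z ≤ y))} proj₁

  𝟘 : Carrier
  𝟘 = ⋁ {I = Lift c ⊥} (λ ())

  U : Carrier
  U = ⋁ {I = Carrier} (λ z → z)

  field
    _·_  : Carrier → Carrier → Carrier
    _‖_  : Carrier → Carrier → Carrier
    1σ   : Carrier
    1π   : Carrier
    1̄π   : Carrier
    -- (Q, ≤, ·, 1σ) unital proto-quantale
    ·-monoʳ  : ∀ {x y} z → x ≤ y → z · x ≤ z · y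
    ·-distribʳ-⋁ : {I : Set c} (f : I → Carrier) (y : Carrier) →
                   ⋁ f · y ≡ ⋁ (λ i → f i · y)
    ·-identityˡ : ∀ x → 1σ · x ≡ x
    ·-identityʳ : ∀ x → x · 1σ ≡ x
    ‖-assoc : ∀ x y z → (x ‖ y) ‖ z ≡ x ‖ (y ‖ z)
    ‖-comm  : ∀ x y → x ‖ y ≡ y ‖ x
    ‖-distribʳ-⋁ : {I : Set c} (f : I → Carrier) (y : Carrier) →
                   ⋁ f ‖ y ≡ ⋁ (λ i → f i ‖ y)
    ‖-distribˡ-⋁ : {I : Set c} (x : Carrier) (f : I → Carrier) →
                   x ‖ ⋁ f ≡ ⋁ (λ i → x ‖ f i)
    ‖-identityˡ : ∀ x → 1π ‖ x ≡ x
    ‖-identityʳ : ∀ x → x ‖ 1π ≡ x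
    distrib : ∀ x y z → x ⊓ (y + z) ≡ (x ⊓ y) + (x ⊓ z)
    cl1  : ∀ x → x · 1π + x · 1̄π ≡ x · U
    cl2  : ∀ x → 1π ⊓ (x + 1̄π) ≡ x · 𝟘
    cl3  : ∀ x y z → x · (y ‖ z) ≤ (x · y) ‖ (x · z)
    cl4  : ∀ x y z → z ‖ z ≤ z → (x ‖ y) · z ≡ (x · z) ‖ (y · z)
    cl5  : ∀ x y z → x · (y · (z · 𝟘)) ≡ (x · y) · (z · 𝟘)
    cl6  : ∀ x y → (x · 𝟘) · y ≡ x · (𝟘 · y)
    cl7  : 1σ ‖ 1σ ≡ 1σ
    cl8  : ∀ x y → ((x · 1π) ‖ 1σ) · y ≡ (x · 1π) ‖ y
    cl9  : ∀ x → ((x ⊓ 1σ) · 1π) ‖ 1σ ≡ x ⊓ 1σ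
    cl10 : ∀ x → ((x ⊓ 1̄π) · 1π) ‖ 1σ ≡ 1σ ⊓ ((x ⊓ 1̄π) · 1̄π)
    cl11 : ∀ x → ((x ⊓ 1̄π) · 1π) ‖ 1̄π ≡ (x ⊓ 1̄π) · 1̄π

  d : Carrier → Carrier
  d x = (x · 1π) ‖ 1σ

  IsGreatestFixpoint : (Carrier → Carrier) → Carrier → Set c
  IsGreatestFixpoint f z = (f z ≡ z) × (∀ y → f y ≡ y → y ≤ z)

  Wellfounded : Carrier → Set c
  Wellfounded x = ∀ y → d y ≤ d (x · y) → d y ≡ 𝟘

  Deflationary : Carrier → Set c
  Deflationary x = ∀ y → y ≤ x · y → y ≡ 𝟘

  -- x^ω = 0, where x^ω is the greatest fixpoint of y ↦ x · y
  OmegaTrivial : Carrier → Set c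
  OmegaTrivial x = ∀ z → IsGreatestFixpoint (x ·_) z → z ≡ 𝟘

-- Deflationary ⇔ ω-trivial is Knaster–Tarski: x^ω is the supremum of all y with
-- y ≤ x · y.  Wellfoundedness reduces to deflationarity because y ≤ d y · y, so
-- d y = 0 forces y = 0, and because d(−) · 1π = (−) · 1π, which turns
-- d y ≤ d (x · y) into y · 1π ≤ x · (y · 1π).
module Submission where

open import Defs
open import Level using (Level; lift) renaming (suc to lsuc)
open import Data.Bool using (true)
open import Data.Product using (_×_; _,_; proj₁; proj₂)
open import Function.Bundles using (_⇔_; mk⇔)
open import Relation.Binary.Bundles using (Poset)
open import Relation.Binary.PropositionalEquality
  using (_≡_; refl; sym; trans; cong; subst; isEquivalence)
import Relation.Binary.Reasoning.PartialOrder as PosetReasoning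

module CQuantaleProperties {c : Level} (Q : CQuantale c) where
  open CQuantale Q

  ≤-reflexive : ∀ {a b} → a ≡ b → a ≤ b
  ≤-reflexive refl = ≤-refl

  poset : Poset c c c
  poset = record
    { Carrier        = Carrier
    ; _≈_            = _≡_
    ; _≤_            = _≤_
    ; isPartialOrder = record
      { isPreorder = record
        { isEquivalence = isEquivalence
        ; reflexive     = ≤-reflexive
        ; trans         = ≤-trans
        }
      ; antisym = ≤-antisym
      }
    }

  open PosetReasoning poset

  𝟘-minimum : ∀ z → 𝟘 ≤ z
  𝟘-minimum z = ⋁-least (λ ()) z (λ ())

  ≤𝟘⇒≡𝟘 : ∀ {z} → z ≤ 𝟘 → z ≡ 𝟘
  ≤𝟘⇒≡𝟘 {z} z≤𝟘 = ≤-antisym z≤𝟘 (𝟘-minimum z)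

  x≤y⇒x⊓y≡x : ∀ {x y} → x ≤ y → x ⊓ y ≡ x
  x≤y⇒x⊓y≡x {x} x≤y = ≤-antisym
    (⋁-least proj₁ x (λ i → proj₁ (proj₂ i)))
    (⋁-upper proj₁ (x , ≤-refl , x≤y))

  ⋁-downset : ∀ b → ⋁ (proj₁ {B = λ w → w ≤ b}) ≡ b
  ⋁-downset b = ≤-antisym (⋁-least proj₁ b proj₂) (⋁-upper proj₁ (b , ≤-refl))

  DistribʳOver⋁ : (Carrier → Carrier → Carrier) → Set (lsuc c)
  DistribʳOver⋁ _∙_ = {I : Set c} (f : I → Carrier) (y : Carrier) →
                      ⋁ f ∙ y ≡ ⋁ (λ i → f i ∙ y)

  module _ (_∙_ : Carrier → Carrier → Carrier) (distrib : DistribʳOver⋁ _∙_) where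

    DistribʳOver⋁⇒monoˡ : ∀ {a b} z → a ≤ b → a ∙ z ≤ b ∙ z
    DistribʳOver⋁⇒monoˡ {a} {b} z a≤b = begin
      a ∙ z                                  ≤⟨ ⋁-upper (λ i → proj₁ i ∙ z) (a , a≤b) ⟩
      ⋁ (λ i → proj₁ {B = λ w → w ≤ b} i ∙ z) ≡⟨ distrib proj₁ z ⟨
      ⋁ (proj₁ {B = λ w → w ≤ b}) ∙ z        ≡⟨ cong (_∙ z) (⋁-downset b) ⟩
      b ∙ z                                  ∎

    DistribʳOver⋁⇒zeroˡ : ∀ y → 𝟘 ∙ y ≡ 𝟘
    DistribʳOver⋁⇒zeroˡ y =
      ≤𝟘⇒≡𝟘 (≤-trans (≤-reflexive (distrib (λ ()) y)) (⋁-least _ 𝟘 (λ ())))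

  ·-monoˡ : ∀ {a b} z → a ≤ b → a · z ≤ b · z
  ·-monoˡ = DistribʳOver⋁⇒monoˡ _·_ ·-distribʳ-⋁

  ·-zeroˡ : ∀ y → 𝟘 · y ≡ 𝟘
  ·-zeroˡ = DistribʳOver⋁⇒zeroˡ _·_ ·-distribʳ-⋁

  ‖-monoˡ : ∀ {a b} z → a ≤ b → a ‖ z ≤ b ‖ z
  ‖-monoˡ = DistribʳOver⋁⇒monoˡ _‖_ ‖-distribʳ-⋁

  ‖-zeroˡ : ∀ y → 𝟘 ‖ y ≡ 𝟘
  ‖-zeroˡ = DistribʳOver⋁⇒zeroˡ _‖_ ‖-distribʳ-⋁

  gfp : (Carrier → Carrier) → Carrier
  gfp f = ⋁ (proj₁ {B = λ w → w ≤ f w})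

  postfixpoint≤gfp : ∀ f {y} → y ≤ f y → y ≤ gfp f
  postfixpoint≤gfp f {y} y≤fy = ⋁-upper proj₁ (y , y≤fy)

  gfp-isGreatestFixpoint : ∀ {f} → (∀ {a b} → a ≤ b → f a ≤ f b) →
                           IsGreatestFixpoint f (gfp f)
  gfp-isGreatestFixpoint {f} f-mono = ≤-antisym f-gfp≤gfp gfp≤f-gfp , greatest
    where
    gfp≤f-gfp : gfp f ≤ f (gfp f)
    gfp≤f-gfp = ⋁-least proj₁ (f (gfp f))
      (λ { (y , y≤fy) → ≤-trans y≤fy (f-mono (postfixpoint≤gfp f y≤fy)) })

    f-gfp≤gfp : f (gfp f) ≤ gfp f
    f-gfp≤gfp = postfixpoint≤gfp f (f-mono gfp≤f-gfp)

    greatest : ∀ y → f y ≡ y → y ≤ gfp f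
    greatest y fy≡y = postfixpoint≤gfp f (≤-reflexive (sym fy≡y))

  d-mono : ∀ {a b} → a ≤ b → d a ≤ d b
  d-mono a≤b = ‖-monoˡ 1σ (·-monoˡ 1π a≤b)

  ≤d· : ∀ y → y ≤ d y · y
  ≤d· y = begin
    y                       ≡⟨ ·-identityʳ y ⟨
    y · 1σ                  ≡⟨ cong (y ·_) (‖-identityˡ 1σ) ⟨
    y · (1π ‖ 1σ)           ≤⟨ cl3 y 1π 1σ ⟩
    (y · 1π) ‖ (y · 1σ)     ≡⟨ cong ((y · 1π) ‖_) (·-identityʳ y) ⟩
    (y · 1π) ‖ y            ≡⟨ cl8 y y ⟨
    d y · y                 ∎

  d≡𝟘⇒≡𝟘 : ∀ {y} → d y ≡ 𝟘 → y ≡ 𝟘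
  d≡𝟘⇒≡𝟘 {y} dy≡𝟘 = ≤𝟘⇒≡𝟘 (begin
    y        ≤⟨ ≤d· y ⟩
    d y · y  ≡⟨ cong (_· y) dy≡𝟘 ⟩
    𝟘 · y    ≡⟨ ·-zeroˡ y ⟩
    𝟘        ∎)

  ·1π≡𝟘⇒d≡𝟘 : ∀ {y} → y · 1π ≡ 𝟘 → d y ≡ 𝟘
  ·1π≡𝟘⇒d≡𝟘 y1π≡𝟘 = trans (cong (_‖ 1σ) y1π≡𝟘) (‖-zeroˡ 1σ)

  d-·1π : ∀ a → d a · 1π ≡ a · 1π
  d-·1π a = trans (cl8 a 1π) (‖-identityʳ (a · 1π))

  1π·𝟘 : 1π · 𝟘 ≡ 1π
  1π·𝟘 = trans (sym (cl2 1π)) (x≤y⇒x⊓y≡x (⋁-upper _ (lift true)))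

  -- cl5 instantiated at z = 1π, since 1π = 1π · 𝟘
  ·-assoc-1π : ∀ x y → (x · y) · 1π ≡ x · (y · 1π)
  ·-assoc-1π x y = subst (λ t → (x · y) · t ≡ x · (y · t)) 1π·𝟘 (sym (cl5 x y 1π))

  d≤d·⇒·1π≤·1π : ∀ x y → d y ≤ d (x · y) → y · 1π ≤ x · (y · 1π)
  d≤d·⇒·1π≤·1π x y dy≤dxy = begin
    y · 1π           ≡⟨ d-·1π y ⟨
    d y · 1π         ≤⟨ ·-monoˡ 1π dy≤dxy ⟩
    d (x · y) · 1π   ≡⟨ d-·1π (x · y) ⟩
    (x · y) · 1π     ≡⟨ ·-assoc-1π x y ⟩
    x · (y · 1π)     ∎

  wellfounded⇒deflationary : ∀ {x} → Wellfounded x → Deflationary x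
  wellfounded⇒deflationary wf y y≤xy = d≡𝟘⇒≡𝟘 (wf y (d-mono y≤xy))

  deflationary⇒wellfounded : ∀ {x} → Deflationary x → Wellfounded x
  deflationary⇒wellfounded {x} df y dy≤dxy =
    ·1π≡𝟘⇒d≡𝟘 (df (y · 1π) (d≤d·⇒·1π≤·1π x y dy≤dxy))

  deflationary⇒omegaTrivial : ∀ {x} → Deflationary x → OmegaTrivial x
  deflationary⇒omegaTrivial df z (xz≡z , _) = df z (≤-reflexive (sym xz≡z))

  omegaTrivial⇒deflationary : ∀ {x} → OmegaTrivial x → Deflationary x
  omegaTrivial⇒deflationary {x} ωt y y≤xy = ≤𝟘⇒≡𝟘 (begin
    y          ≤⟨ postfixpoint≤gfp (x ·_) y≤xy ⟩
    gfp (x ·_) ≡⟨ ωt (gfp (x ·_)) (gfp-isGreatestFixpoint (·-monoʳ x)) ⟩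
    𝟘          ∎)

proposition73 : {c : Level} (Q : CQuantale c) (x : CQuantale.Carrier Q) →
    ((CQuantale.Wellfounded Q x ⇔ CQuantale.Deflationary Q x)
      × (CQuantale.Deflationary Q x ⇔ CQuantale.OmegaTrivial Q x))
proposition73 Q x =
  mk⇔ wellfounded⇒deflationary deflationary⇒wellfounded ,
  mk⇔ deflationary⇒omegaTrivial omegaTrivial⇒deflationary
  where open CQuantaleProperties Q
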